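{- Let $a,b$ be integers with $1\leq a\leq b$. The number $\varphi_0(a,b)$ of Dyck paths having exactly two peaks in the interval $[UD,U^aD^aU^bD^b]$ of the Dyck pattern poset is $$\varphi_0(a,b)=\frac{a(a+1)(3b-a+1)}{6}.$$
   Context: A Dyck path is a word over $\{U,D\}$ with equally many $U$'s and $D$'s such that every prefix has at least as many $U$'s as $D$'s; its semilength is its number of $U$'s. The Dyck pattern poset is the set of nonempty Dyck paths ordered by $P\leq Q$ iff $P$ is a subword of $Q$ (obtained by deleting letters, not necessarily consecutive). A peak is an occurrence of $UD$ as two consecutive letters. $U^a$ denotes $a$ consecutive $U$'s. The paper assumes throughout this section that $b\geq a\geq1$. -}

module Defs where

open import Data.Nat using (ℕ; zero; suc; _+_; _≤_)
open import Data.List using (List; []; _∷_; replicate; _++_)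

data Step : Set where
  U D : Step

Word : Set
Word = List Step

-- Dyck condition, read left to right with the current height h:
-- every prefix has at least as many U's as D's, and the word ends at height 0.
data DyckFrom : ℕ → Word → Set where
  done : DyckFrom zero []
  up   : ∀ {h w} → DyckFrom (suc h) w → DyckFrom h (U ∷ w)
  down : ∀ {h w} → DyckFrom h w → DyckFrom (suc h) (D ∷ w)

IsDyck : Word → Set
IsDyck w = DyckFrom zero w

data _≼_ : Word → Word → Set where
  []≼  : [] ≼ []
  keep : ∀ {x p q} → p ≼ q → (x ∷ p) ≼ (x ∷ q)
  skip : ∀ {x p q} → p ≼ q → p ≼ (x ∷ q)

peaks : Word → ℕ
peaks []            = zero
peaks (U ∷ D ∷ w)   = suc (peaks (D ∷ w))
peaks (U ∷ U ∷ w)   = peaks (U ∷ w)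
peaks (U ∷ [])      = zero
peaks (D ∷ w)       = peaks w

twoPeak : ℕ → ℕ → Word
twoPeak a b = replicate a U ++ replicate a D ++ replicate b U ++ replicate b D

UD : Word
UD = U ∷ D ∷ []

InIntervalTwoPeaks : ℕ → ℕ → Word → Set
InIntervalTwoPeaks a b P =
  IsDyck P × (UD ≼ P) × (P ≼ twoPeak a b) × (peaks P ≡ 2)
  where
    open import Data.Product using (_×_)
    open import Relation.Binary.PropositionalEquality using (_≡_)

-- A subword of U^a D^a U^b D^b is a word U^i D^j U^k D^l with i, j ≤ a and
-- k, l ≤ b. It is a Dyck path iff i = j + d and l = k + d for some valley
-- height d, and it then has two peaks iff j, k ≥ 1. So the paths counted are
-- U^(j+d) D^j U^k D^(k+d) with 1 ≤ j ≤ a − d and 1 ≤ k ≤ b − d, one for each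
-- such triple (d, j, k), and there are Σ_{d<a} (a − d)(b − d) of them.
module Submission where

open import Defs
open import Data.Nat using (ℕ; suc; _+_; _*_; _∸_; _≤_)
open import Data.List using (List; length)
open import Data.List.Membership.Propositional using (_∈_)
open import Data.List.Relation.Unary.Unique.Propositional using (Unique)
open import Data.Product using (Σ; _×_)
open import Relation.Binary.PropositionalEquality using (_≡_)
open import Function.Bundles using (_⇔_)

open import Data.Nat using (zero; pred; _<_; z≤n; s≤s)
open import Data.Nat.Properties
open import Data.Nat.Tactic.RingSolver using (solve-∀)
open import Data.List using ([]; _∷_; _++_; replicate; map; upTo; cartesianProduct)
open import Data.List.Properties using (∷-injective; ++-assoc; ++-identityʳ; length-++; length-map; length-upTo)
open import Data.List.Membership.Propositional.Properties
  using (∈-map⁺; ∈-map⁻; ∈-++⁺ˡ; ∈-++⁺ʳ; ∈-++⁻; ∈-cartesianProduct⁺; ∈-cartesianProduct⁻; ∈-upTo⁺; ∈-upTo⁻)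
open import Data.List.Relation.Binary.Disjoint.Propositional using (Disjoint)
import Data.List.Relation.Unary.Unique.Propositional.Properties as Unique
import Data.List.Relation.Unary.AllPairs as AllPairs
open import Data.Product using (∃-syntax; _,_; proj₂; map₁)
open import Data.Sum using (inj₁; inj₂)
open import Data.Empty using (⊥-elim)
open import Relation.Binary.PropositionalEquality
  using (_≢_; refl; sym; trans; cong; cong₂; subst; module ≡-Reasoning)
open import Function.Bundles using (mk⇔)

blocks : ℕ → ℕ → ℕ → ℕ → Word
blocks i j k l = replicate i U ++ replicate j D ++ replicate k U ++ replicate l D

replicate-+ : ∀ {A : Set} m n (x : A) → replicate (m + n) x ≡ replicate m x ++ replicate n x
replicate-+ zero    n x = refl
replicate-+ (suc m) n x = cong (x ∷_) (replicate-+ m n x)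

replicate-++-∷-injective : ∀ {A : Set} {x y : A} {v w} m n → x ≢ y →
  replicate m x ++ y ∷ v ≡ replicate n x ++ y ∷ w → m ≡ n × v ≡ w
replicate-++-∷-injective zero    zero    x≢y eq = refl , proj₂ (∷-injective eq)
replicate-++-∷-injective zero    (suc n) x≢y refl = ⊥-elim (x≢y refl)
replicate-++-∷-injective (suc m) zero    x≢y refl = ⊥-elim (x≢y refl)
replicate-++-∷-injective (suc m) (suc n) x≢y eq
  with m≡n , v≡w ← replicate-++-∷-injective m n x≢y (proj₂ (∷-injective eq)) =
  cong suc m≡n , v≡w

replicate-mono-≼ : ∀ {m n} x → m ≤ n → replicate m x ≼ replicate n x
replicate-mono-≼ {zero} {zero}  x z≤n       = []≼
replicate-mono-≼ {zero} {suc n} x z≤n       = skip (replicate-mono-≼ x z≤n)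
replicate-mono-≼        x       (s≤s m≤n) = keep (replicate-mono-≼ x m≤n)

replicate-++-mono-≼ : ∀ {m n} x {p q} → m ≤ n → p ≼ q → (replicate m x ++ p) ≼ (replicate n x ++ q)
replicate-++-mono-≼ {zero} {zero}  x z≤n       p≼q = p≼q
replicate-++-mono-≼ {zero} {suc n} x z≤n       p≼q = skip (replicate-++-mono-≼ x z≤n p≼q)
replicate-++-mono-≼        x       (s≤s m≤n) p≼q = keep (replicate-++-mono-≼ x m≤n p≼q)

blocks-mono-≼ : ∀ {i j k l i′ j′ k′ l′} → i′ ≤ i → j′ ≤ j → k′ ≤ k → l′ ≤ l →
  blocks i′ j′ k′ l′ ≼ blocks i j k l
blocks-mono-≼ i′≤i j′≤j k′≤k l′≤l =
  replicate-++-mono-≼ U i′≤i (replicate-++-mono-≼ D j′≤j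
    (replicate-++-mono-≼ U k′≤k (replicate-mono-≼ D l′≤l)))

≼-replicate⁻ : ∀ n x {p} → p ≼ replicate n x → ∃[ m ] m ≤ n × p ≡ replicate m x
≼-replicate⁻ zero    x []≼ = 0 , z≤n , refl
≼-replicate⁻ (suc n) x (keep p≼xs) with m , m≤n , refl ← ≼-replicate⁻ n x p≼xs = suc m , s≤s m≤n , refl
≼-replicate⁻ (suc n) x (skip p≼xs) with m , m≤n , refl ← ≼-replicate⁻ n x p≼xs = m , m≤n⇒m≤1+n m≤n , refl

≼-replicate-++⁻ : ∀ n x {p q} → p ≼ (replicate n x ++ q) →
  ∃[ m ] m ≤ n × ∃[ r ] p ≡ replicate m x ++ r × r ≼ q
≼-replicate-++⁻ zero    x p≼q = 0 , z≤n , _ , refl , p≼q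
≼-replicate-++⁻ (suc n) x (keep p≼xs) with m , m≤n , r , refl , r≼q ← ≼-replicate-++⁻ n x p≼xs =
  suc m , s≤s m≤n , r , refl , r≼q
≼-replicate-++⁻ (suc n) x (skip p≼xs) with m , m≤n , r , refl , r≼q ← ≼-replicate-++⁻ n x p≼xs =
  m , m≤n⇒m≤1+n m≤n , r , refl , r≼q

data SubBlocks (i j k l : ℕ) : Word → Set where
  subBlocks : ∀ {i′ j′ k′ l′} → i′ ≤ i → j′ ≤ j → k′ ≤ k → l′ ≤ l →
              SubBlocks i j k l (blocks i′ j′ k′ l′)

≼-blocks⁻ : ∀ i j k l {P} → P ≼ blocks i j k l → SubBlocks i j k l P
≼-blocks⁻ i j k l P≼
  with i′ , i′≤i , _ , refl , P₁≼ ← ≼-replicate-++⁻ i U P≼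
  with j′ , j′≤j , _ , refl , P₂≼ ← ≼-replicate-++⁻ j D P₁≼
  with k′ , k′≤k , _ , refl , P₃≼ ← ≼-replicate-++⁻ k U P₂≼
  with l′ , l′≤l , refl         ← ≼-replicate⁻ l D P₃≼
  = subBlocks i′≤i j′≤j k′≤k l′≤l

DyckFrom-replicateU⁻ : ∀ n {h w} → DyckFrom h (replicate n U ++ w) → DyckFrom (n + h) w
DyckFrom-replicateU⁻ zero    d      = d
DyckFrom-replicateU⁻ (suc n) {h} {w} (up d) =
  subst (λ h′ → DyckFrom h′ w) (+-suc n h) (DyckFrom-replicateU⁻ n d)

DyckFrom-replicateU⁺ : ∀ n {h w} → DyckFrom (n + h) w → DyckFrom h (replicate n U ++ w)
DyckFrom-replicateU⁺ zero    d = d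
DyckFrom-replicateU⁺ (suc n) {h} {w} d =
  up (DyckFrom-replicateU⁺ n (subst (λ h′ → DyckFrom h′ w) (sym (+-suc n h)) d))

DyckFrom-replicateD⁻ : ∀ n {h w} → DyckFrom h (replicate n D ++ w) → ∃[ h′ ] h ≡ n + h′ × DyckFrom h′ w
DyckFrom-replicateD⁻ zero    d        = _ , refl , d
DyckFrom-replicateD⁻ (suc n) (down d) with h′ , refl , d′ ← DyckFrom-replicateD⁻ n d = h′ , refl , d′

DyckFrom-replicateD⁺ : ∀ n {h w} → DyckFrom h w → DyckFrom (n + h) (replicate n D ++ w)
DyckFrom-replicateD⁺ zero    d = d
DyckFrom-replicateD⁺ (suc n) d = down (DyckFrom-replicateD⁺ n d)

DyckFrom-replicateD-height : ∀ n {h} → DyckFrom h (replicate n D) → h ≡ n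
DyckFrom-replicateD-height zero    done     = refl
DyckFrom-replicateD-height (suc n) (down d) = cong suc (DyckFrom-replicateD-height n d)

DyckFrom-replicateD : ∀ n → DyckFrom n (replicate n D)
DyckFrom-replicateD zero    = done
DyckFrom-replicateD (suc n) = down (DyckFrom-replicateD n)

blocks-isDyck⁻ : ∀ i j k l → IsDyck (blocks i j k l) → ∃[ h ] i ≡ j + h × l ≡ k + h
blocks-isDyck⁻ i j k l dyck
  with h , i+0≡j+h , dyck′ ← DyckFrom-replicateD⁻ j (DyckFrom-replicateU⁻ i dyck) =
  h , trans (sym (+-identityʳ i)) i+0≡j+h ,
  sym (DyckFrom-replicateD-height l (DyckFrom-replicateU⁻ k dyck′))

blocks-isDyck⁺ : ∀ h j k → IsDyck (blocks (j + h) j k (k + h))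
blocks-isDyck⁺ h j k =
  DyckFrom-replicateU⁺ (j + h)
    (subst (λ h′ → DyckFrom h′ (blocks 0 j k (k + h))) (sym (+-identityʳ (j + h)))
      (DyckFrom-replicateD⁺ j (DyckFrom-replicateU⁺ k (DyckFrom-replicateD (k + h)))))

peaks-replicateU : ∀ n → peaks (replicate n U) ≡ 0
peaks-replicateU zero          = refl
peaks-replicateU (suc zero)    = refl
peaks-replicateU (suc (suc n)) = peaks-replicateU (suc n)

peaks-replicateD-++ : ∀ n w → peaks (replicate n D ++ w) ≡ peaks w
peaks-replicateD-++ zero    w = refl
peaks-replicateD-++ (suc n) w = peaks-replicateD-++ n w

peaks-replicateD : ∀ n → peaks (replicate n D) ≡ 0
peaks-replicateD n = trans (cong peaks (sym (++-identityʳ (replicate n D)))) (peaks-replicateD-++ n [])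

peaks-replicateU-++-D∷ : ∀ n w → peaks (replicate (suc n) U ++ D ∷ w) ≡ suc (peaks w)
peaks-replicateU-++-D∷ zero    w = refl
peaks-replicateU-++-D∷ (suc n) w = peaks-replicateU-++-D∷ n w

peaks-replicateU-++-replicateD : ∀ m n → peaks (replicate m U ++ replicate n D) ≤ 1
peaks-replicateU-++-replicateD m zero =
  subst (_≤ 1) (sym (trans (cong peaks (++-identityʳ (replicate m U))) (peaks-replicateU m))) z≤n
peaks-replicateU-++-replicateD zero    (suc n) = subst (_≤ 1) (sym (peaks-replicateD n)) z≤n
peaks-replicateU-++-replicateD (suc m) (suc n) =
  ≤-reflexive (trans (peaks-replicateU-++-D∷ m (replicate n D)) (cong suc (peaks-replicateD n)))

peaks-blocks : ∀ i j k l → peaks (blocks (suc i) (suc j) (suc k) (suc l)) ≡ 2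
peaks-blocks i j k l = begin
  peaks (blocks (suc i) (suc j) (suc k) (suc l))                 ≡⟨ peaks-replicateU-++-D∷ i _ ⟩
  suc (peaks (replicate j D ++ blocks 0 0 (suc k) (suc l)))       ≡⟨ cong suc (peaks-replicateD-++ j _) ⟩
  suc (peaks (replicate (suc k) U ++ D ∷ replicate l D))          ≡⟨ cong suc (peaks-replicateU-++-D∷ k _) ⟩
  2 + peaks (replicate l D)                                       ≡⟨ cong (2 +_) (peaks-replicateD l) ⟩
  2                                                               ∎
  where open ≡-Reasoning

-- A Dyck word U^(j+h) D^j U^k D^(k+h) with j = 0 or k = 0 is U^m D^m, a single peak.
dyckBlocks-twoPeaks⁻ : ∀ h j k → peaks (blocks (j + h) j k (k + h)) ≡ 2 → 1 ≤ j × 1 ≤ k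
dyckBlocks-twoPeaks⁻ h zero k two = ⊥-elim (<⇒≢ (s≤s onePeak) two)
  where
    merged : blocks h 0 k (k + h) ≡ replicate (h + k) U ++ replicate (k + h) D
    merged = trans (sym (++-assoc (replicate h U) (replicate k U) _))
                   (cong (_++ replicate (k + h) D) (sym (replicate-+ h k U)))
    onePeak : peaks (blocks h 0 k (k + h)) ≤ 1
    onePeak = subst (λ w → peaks w ≤ 1) (sym merged)
                (peaks-replicateU-++-replicateD (h + k) (k + h))
dyckBlocks-twoPeaks⁻ h (suc j) zero two = ⊥-elim (<⇒≢ (s≤s onePeak) two)
  where
    merged : blocks (suc j + h) (suc j) 0 h ≡ replicate (suc j + h) U ++ replicate (suc j + h) D
    merged = cong (replicate (suc j + h) U ++_) (sym (replicate-+ (suc j) h D))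
    onePeak : peaks (blocks (suc j + h) (suc j) 0 h) ≤ 1
    onePeak = subst (λ w → peaks w ≤ 1) (sym merged)
                (peaks-replicateU-++-replicateD (suc j + h) (suc j + h))
dyckBlocks-twoPeaks⁻ h (suc j) (suc k) two = s≤s z≤n , s≤s z≤n

Shape : Set
Shape = ℕ × ℕ × ℕ

-- The valley lies at height d; j and k are shifted by one so that both peaks exist.
valleyPath : Shape → Word
valleyPath (d , j , k) = blocks (suc j + d) (suc j) (suc k) (suc k + d)

ValleyShape : ℕ → ℕ → Shape → Set
ValleyShape a b (d , j , k) = j + d < a × k + d < b

valleyPath-injective : ∀ {s t} → valleyPath s ≡ valleyPath t → s ≡ t
valleyPath-injective {d , j , k} {d′ , j′ , k′} eq
  with j+d≡j′+d′ , eq₁ ← replicate-++-∷-injective (suc j + d) (suc j′ + d′) (λ ()) eq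
  with refl , eq₂ ← replicate-++-∷-injective j j′ (λ ()) eq₁
  with refl , _ ← replicate-++-∷-injective k k′ (λ ()) eq₂
  with refl ← +-cancelˡ-≡ (suc j) d d′ j+d≡j′+d′
  = refl

valleyPath-inInterval : ∀ a b {t} → ValleyShape a b t → InIntervalTwoPeaks a b (valleyPath t)
valleyPath-inInterval a b {d , j , k} (j+d<a , k+d<b) =
  blocks-isDyck⁺ d (suc j) (suc k) ,
  blocks-mono-≼ {suc j + d} {suc j} {suc k} {suc k + d} {1} {1} {0} {0} (s≤s z≤n) (s≤s z≤n) z≤n z≤n ,
  blocks-mono-≼ j+d<a (≤-trans (m≤m+n (suc j) d) j+d<a) (≤-trans (m≤m+n (suc k) d) k+d<b) k+d<b ,
  peaks-blocks (j + d) j k (k + d)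

inInterval⇒valleyPath : ∀ a b {P} → InIntervalTwoPeaks a b P → ∃[ t ] ValleyShape a b t × P ≡ valleyPath t
inInterval⇒valleyPath a b (dyck , _ , P≼ , two) with ≼-blocks⁻ a a b b P≼
... | subBlocks {i} {j} {k} {l} i≤a _ _ l≤b
  with h , refl , refl ← blocks-isDyck⁻ i j k l dyck
  with s≤s z≤n , s≤s z≤n ← dyckBlocks-twoPeaks⁻ h j k two
  = (h , _ , _) , (i≤a , l≤b) , refl

grid : ℕ → ℕ → List (ℕ × ℕ)
grid m n = cartesianProduct (upTo m) (upTo n)

atGround : ℕ × ℕ → Shape
atGround (j , k) = 0 , j , k

deepen : Shape → Shape
deepen = map₁ suc

valleyShapes : ℕ → ℕ → List Shape
valleyShapes zero    c = []
valleyShapes (suc n) c =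
  map atGround (grid (suc n) (suc n + c)) ++ map deepen (valleyShapes n c)

∈-valleyShapes⁻ : ∀ n c {t} → t ∈ valleyShapes n c → ValleyShape n (n + c) t
∈-valleyShapes⁻ (suc n) c {t} t∈ with ∈-++⁻ (map atGround (grid (suc n) (suc n + c))) t∈
... | inj₁ t∈grid
  with (j , k) , jk∈ , refl ← ∈-map⁻ atGround t∈grid
  with j∈ , k∈ ← ∈-cartesianProduct⁻ (upTo (suc n)) (upTo (suc n + c)) jk∈
  = subst (_< suc n) (sym (+-identityʳ j)) (∈-upTo⁻ j∈) ,
    subst (_< suc n + c) (sym (+-identityʳ k)) (∈-upTo⁻ k∈)
... | inj₂ t∈deeper
  with (d , j , k) , t∈′ , refl ← ∈-map⁻ deepen t∈deeper
  with j+d<n , k+d<n+c ← ∈-valleyShapes⁻ n c t∈′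
  = subst (_< suc n) (sym (+-suc j d)) (s≤s j+d<n) ,
    subst (_< suc n + c) (sym (+-suc k d)) (s≤s k+d<n+c)

∈-valleyShapes⁺ : ∀ n c {t} → ValleyShape n (n + c) t → t ∈ valleyShapes n c
∈-valleyShapes⁺ (suc n) c {zero , j , k} (j+0<n , k+0<n+c) =
  ∈-++⁺ˡ (∈-map⁺ atGround (∈-cartesianProduct⁺
    (∈-upTo⁺ (subst (_< suc n) (+-identityʳ j) j+0<n))
    (∈-upTo⁺ (subst (_< suc n + c) (+-identityʳ k) k+0<n+c))))
∈-valleyShapes⁺ (suc n) c {suc d , j , k} (j+d<n , k+d<n+c) =
  ∈-++⁺ʳ (map atGround (grid (suc n) (suc n + c))) (∈-map⁺ deepen (∈-valleyShapes⁺ n c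
    (≤-pred (subst (_< suc n) (+-suc j d) j+d<n) ,
     ≤-pred (subst (_< suc n + c) (+-suc k d) k+d<n+c))))

valleyShapes-unique : ∀ n c → Unique (valleyShapes n c)
valleyShapes-unique zero    c = AllPairs.[]
valleyShapes-unique (suc n) c =
  Unique.++⁺ (Unique.map⁺ (cong proj₂)
               (Unique.cartesianProduct⁺ (Unique.upTo⁺ (suc n)) (Unique.upTo⁺ (suc n + c))))
             (Unique.map⁺ (cong (map₁ pred)) (valleyShapes-unique n c))
             valleysDisjoint
  where
    valleysDisjoint : Disjoint (map atGround (grid (suc n) (suc n + c))) (map deepen (valleyShapes n c))
    valleysDisjoint (t∈grid , t∈deeper)
      with _ , _ , refl ← ∈-map⁻ atGround t∈grid
      with _ , _ , ()   ← ∈-map⁻ deepen t∈deeper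

length-cartesianProduct : ∀ {A B : Set} (xs : List A) (ys : List B) →
  length (cartesianProduct xs ys) ≡ length xs * length ys
length-cartesianProduct []       ys = refl
length-cartesianProduct (x ∷ xs) ys =
  trans (length-++ (map (x ,_) ys)) (cong₂ _+_ (length-map (x ,_) ys) (length-cartesianProduct xs ys))

length-grid : ∀ m n → length (grid m n) ≡ m * n
length-grid m n = trans (length-cartesianProduct (upTo m) (upTo n)) (cong₂ _*_ (length-upTo m) (length-upTo n))

length-valleyShapes-suc : ∀ n c →
  length (valleyShapes (suc n) c) ≡ suc n * (suc n + c) + length (valleyShapes n c)
length-valleyShapes-suc n c =
  trans (length-++ (map atGround (grid (suc n) (suc n + c))) {map deepen (valleyShapes n c)})
        (cong₂ _+_ (trans (length-map atGround (grid (suc n) (suc n + c))) (length-grid (suc n) (suc n + c)))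
                   (length-map deepen (valleyShapes n c)))

length-valleyShapes : ∀ n c → 6 * length (valleyShapes n c) ≡ n * (n + 1) * (2 * n + 3 * c + 1)
length-valleyShapes zero    c = refl
length-valleyShapes (suc n) c = begin
  6 * length (valleyShapes (suc n) c)
    ≡⟨ cong (6 *_) (length-valleyShapes-suc n c) ⟩
  6 * (suc n * (suc n + c) + length (valleyShapes n c))
    ≡⟨ *-distribˡ-+ 6 (suc n * (suc n + c)) _ ⟩
  6 * (suc n * (suc n + c)) + 6 * length (valleyShapes n c)
    ≡⟨ cong (6 * (suc n * (suc n + c)) +_) (length-valleyShapes n c) ⟩
  6 * (suc n * (suc n + c)) + n * (n + 1) * (2 * n + 3 * c + 1)
    ≡⟨ sumStep n c ⟩
  suc n * (suc n + 1) * (2 * suc n + 3 * c + 1) ∎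
  where
    open ≡-Reasoning
    sumStep : ∀ n c → 6 * ((1 + n) * ((1 + n) + c)) + n * (n + 1) * (2 * n + 3 * c + 1)
                    ≡ (1 + n) * ((1 + n) + 1) * (2 * (1 + n) + 3 * c + 1)
    sumStep = solve-∀

∈-valleyPaths⇔ : ∀ a c P → P ∈ map valleyPath (valleyShapes a c) ⇔ InIntervalTwoPeaks a (a + c) P
∈-valleyPaths⇔ a c P = mk⇔ to from
  where
    to : P ∈ map valleyPath (valleyShapes a c) → InIntervalTwoPeaks a (a + c) P
    to P∈ with _ , t∈ , refl ← ∈-map⁻ valleyPath P∈ =
      valleyPath-inInterval a (a + c) (∈-valleyShapes⁻ a c t∈)
    from : InIntervalTwoPeaks a (a + c) P → P ∈ map valleyPath (valleyShapes a c)
    from P∈ with _ , shape , refl ← inInterval⇒valleyPath a (a + c) P∈ =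
      ∈-map⁺ valleyPath (∈-valleyShapes⁺ a c shape)

length-valleyPaths : ∀ a c → 6 * length (map valleyPath (valleyShapes a c)) ≡ a * (a + 1) * (3 * (a + c) + 1 ∸ a)
length-valleyPaths a c = begin
  6 * length (map valleyPath (valleyShapes a c)) ≡⟨ cong (6 *_) (length-map valleyPath (valleyShapes a c)) ⟩
  6 * length (valleyShapes a c)                  ≡⟨ length-valleyShapes a c ⟩
  a * (a + 1) * (2 * a + 3 * c + 1)             ≡⟨ cong (a * (a + 1) *_) (sym (m+n∸n≡m (2 * a + 3 * c + 1) a)) ⟩
  a * (a + 1) * (2 * a + 3 * c + 1 + a ∸ a)     ≡⟨ cong (λ m → a * (a + 1) * (m ∸ a)) (regroup a c) ⟩
  a * (a + 1) * (3 * (a + c) + 1 ∸ a)           ∎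
  where
    open ≡-Reasoning
    regroup : ∀ a c → 2 * a + 3 * c + 1 + a ≡ 3 * (a + c) + 1
    regroup = solve-∀

-- The count holds for a = 0 as well.
proposition3 : (a b : ℕ) → 1 ≤ a → a ≤ b →
    Σ (List Word) (λ L →
    Unique L × ((P : Word) → (P ∈ L) ⇔ InIntervalTwoPeaks a b P)
    × (6 * length L ≡ a * (a + 1) * (3 * b + 1 ∸ a)))
proposition3 a b _ a≤b with c , refl ← m≤n⇒∃[o]m+o≡n a≤b =
  map valleyPath (valleyShapes a c) ,
  Unique.map⁺ valleyPath-injective (valleyShapes-unique a c) ,
  ∈-valleyPaths⇔ a c ,
  length-valleyPaths a c
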